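{- Let $\Delta,x:A\vdash M:B$ be a valid typing judgment. Then for every free occurrence $x^{A'}$ of the variable $x$ in $M$ (carrying type annotation $A'$), we have $A<:A'$.
   Context: Types: $A,B ::= \alpha \mid (A\multimap B)\mid (A\otimes B)\mid \mathbf{1}\mid {!A}$, with $\alpha$ ranging over a fixed set of type constants; ${!^n}A$ denotes $A$ preceded by $n$ copies of $!$. Subtyping $<:$ is the least relation closed under the following rules, each usable whenever the integers $n,m\ge 0$ satisfy ($m=0$ or $n\ge 1$): ${!^n}\alpha<:{!^m}\alpha$; ${!^n}\mathbf{1}<:{!^m}\mathbf{1}$; if $A<:A'$ and $B<:B'$ then ${!^n}(A'\multimap B)<:{!^m}(A\multimap B')$; if $A<:A'$ and $B<:B'$ then ${!^n}(A\otimes B)<:{!^m}(A'\otimes B')$. Indexed terms ($n$ a nonnegative integer, $x,y$ variables, $c$ from a set of constants, each constant $c$ being assigned a type ${!A_c}$): core values $U ::= x^A \mid c^A \mid *^n \mid \lambda^n x^A.M$; values $V,W ::= U \mid \langle V,W\rangle^n \mid (\lambda^0x^A.W)V \mid \mathrm{let}\ \langle x^A,y^B\rangle^n=V\ \mathrm{in}\ W \mid \mathrm{let}\ *=V\ \mathrm{in}\ W$; terms $M,N ::= U\mid \langle M,N\rangle^n\mid MN\mid \mathrm{let}\ \langle x^A,y^B\rangle^n=M\ \mathrm{in}\ N\mid \mathrm{let}\ *=M\ \mathrm{in}\ N$. $\lambda^n x^A.M$ binds $x$ in $M$; $\mathrm{let}\ \langle x^A,y^B\rangle^n=M\ \mathrm{in}\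 N$ binds $x,y$ in $N$; free occurrences are the usual ones. A context is a finite list $x_1:A_1,\dots,x_k:A_k$ of distinct variables with types; $\Gamma,\Delta$ denotes juxtaposition of contexts with disjoint variables; ${!\Delta}$ denotes a context all of whose types are of the form ${!B}$. A typing judgment $\Delta\vdash M:A$ is valid if derivable by the rules: (ax1) ${!\Delta},x:A\vdash x^B:B$ if $A<:B$; (ax2) ${!\Delta}\vdash c^B:B$ if $A_c<:B$; (app) from $\Gamma_1,{!\Delta}\vdash M:A\multimap B$ and $\Gamma_2,{!\Delta}\vdash N:A$ infer $\Gamma_1,\Gamma_2,{!\Delta}\vdash MN:B$; ($\lambda_1$) from $\Delta,x:A\vdash M:B$ infer $\Delta\vdash\lambda^0x^A.M:A\multimap B$; ($\lambda_2$) from ${!\Delta},x:A\vdash M:B$ infer ${!\Delta}\vdash \lambda^{n+1}x^A.M:{!^{n+1}}(A\multimap B)$; ($\mathbf 1$.I) ${!\Delta}\vdash *^n:{!^n}\mathbf{1}$; ($\otimes$.I) from ${!\Delta},\Gamma_1\vdash M_1:{!^n}A_1$ and ${!\Delta},\Gamma_2\vdash M_2:{!^n}A_2$ infer ${!\Delta},\Gamma_1,\Gamma_2\vdash\langle M_1,M_2\rangle^n:{!^n}(A_1\otimes A_2)$; ($\mathbf 1$.E) from ${!\Delta},\Gamma_1\vdash M:\mathbf{1}$ and ${!\Delta},\Gamma_2\vdash N:A$ infer ${!\Delta},\Gamma_1,\Gamma_2\vdash \mathrm{let}\ *=M\ \mathrm{in}\ N:A$; ($\otimes$.E) from ${!\Delta},\Gamma_1\vdash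 M:{!^n}(A_1\otimes A_2)$ and ${!\Delta},\Gamma_2,x_1:{!^n}A_1,x_2:{!^n}A_2\vdash N:A$ infer ${!\Delta},\Gamma_1,\Gamma_2\vdash \mathrm{let}\ \langle x_1^{A_1},x_2^{A_2}\rangle^n=M\ \mathrm{in}\ N:A$. -}

module Defs where

open import Data.Nat using (ℕ; zero; suc; _≤_)
open import Data.Sum using (_⊎_)
open import Data.Product using (_×_; _,_; proj₁; proj₂)
open import Data.List using (List; []; _∷_; _++_; map)
open import Data.List.Relation.Unary.All using (All)
open import Data.List.Relation.Unary.Unique.Propositional using (Unique)
open import Data.List.Relation.Binary.Permutation.Propositional using (_↭_)
open import Relation.Binary.PropositionalEquality using (_≡_; _≢_)

infixr 30 _⊸_
infixr 35 _⊗_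

data Ty : Set where
  base : ℕ → Ty
  _⊸_  : Ty → Ty → Ty
  _⊗_  : Ty → Ty → Ty
  𝟏    : Ty
  !_   : Ty → Ty

!^ : ℕ → Ty → Ty
!^ zero    A = A
!^ (suc n) A = ! (!^ n A)

Ok : ℕ → ℕ → Set
Ok n m = (m ≡ 0) ⊎ (1 ≤ n)

infix 4 _<:_

data _<:_ : Ty → Ty → Set where
  sub-base : ∀ {n m} a → Ok n m → !^ n (base a) <: !^ m (base a)
  sub-one  : ∀ {n m} → Ok n m → !^ n 𝟏 <: !^ m 𝟏
  sub-⊸    : ∀ {n m A A' B B'} → Ok n m → A <: A' → B <: B' →
             !^ n (A' ⊸ B) <: !^ m (A ⊸ B')
  sub-⊗    : ∀ {n m A A' B B'} → Ok n m → A <: A' → B <: B' →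
             !^ n (A ⊗ B) <: !^ m (A' ⊗ B')

Var : Set
Var = ℕ

Const : Set
Const = ℕ

data Term : Set where
  var     : Var → Ty → Term                       -- x^A
  con     : Const → Ty → Term                     -- c^A
  star    : ℕ → Term                              -- *^n
  lam     : ℕ → Var → Ty → Term → Term            -- λ^n x^A. M
  pair    : ℕ → Term → Term → Term                -- ⟨M,N⟩^n
  app     : Term → Term → Term
  letpair : ℕ → Var → Ty → Var → Ty → Term → Term → Term
                                                  -- let ⟨x^A,y^B⟩^n = M in N
  letstar : Term → Term → Term

data FreeOcc (x : Var) (A' : Ty) : Term → Set where
  occ-var       : FreeOcc x A' (var x A')
  occ-lam       : ∀ {n y B M} → x ≢ y → FreeOcc x A' M → FreeOcc x A' (lam n y B M)
  occ-pairˡ     : ∀ {n M N} → FreeOcc x A' M → FreeOcc x A' (pair n M N)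
  occ-pairʳ     : ∀ {n M N} → FreeOcc x A' N → FreeOcc x A' (pair n M N)
  occ-appˡ      : ∀ {M N} → FreeOcc x A' M → FreeOcc x A' (app M N)
  occ-appʳ      : ∀ {M N} → FreeOcc x A' N → FreeOcc x A' (app M N)
  occ-letpairˡ  : ∀ {n y B z C M N} → FreeOcc x A' M →
                  FreeOcc x A' (letpair n y B z C M N)
  occ-letpairʳ  : ∀ {n y B z C M N} → x ≢ y → x ≢ z → FreeOcc x A' N →
                  FreeOcc x A' (letpair n y B z C M N)
  occ-letstarˡ  : ∀ {M N} → FreeOcc x A' M → FreeOcc x A' (letstar M N)
  occ-letstarʳ  : ∀ {M N} → FreeOcc x A' N → FreeOcc x A' (letstar M N)

-- Juxtaposition is list concatenation; contexts are taken up to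
-- permutation (each rule's conclusion may be any permutation of the
-- juxtaposition), and every context in a judgment must have distinct
-- variables (which also enforces disjointness of juxtaposed parts).

Ctx : Set
Ctx = List (Var × Ty)

Distinct : Ctx → Set
Distinct Θ = Unique (map proj₁ Θ)

data IsBang : Ty → Set where
  isBang : ∀ B → IsBang (! B)

Banged : Ctx → Set
Banged Δ = All (λ p → IsBang (proj₂ p)) Δ

-- Typing judgments, relative to the assignment c ↦ A_c of constants
-- (constant c has type !A_c; Aᶜ c is A_c).

module Typing (Aᶜ : Const → Ty) where

  infix 3 _⊢_∶_

  data _⊢_∶_ : Ctx → Term → Ty → Set where
    ax1 : ∀ {Θ Δ x A B} → Banged Δ → A <: B →
          Θ ↭ (Δ ++ (x , A) ∷ []) → Distinct Θ →
          Θ ⊢ var x B ∶ B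
    ax2 : ∀ {Θ Δ c B} → Banged Δ → Aᶜ c <: B →
          Θ ↭ Δ → Distinct Θ →
          Θ ⊢ con c B ∶ B
    app : ∀ {Θ Γ₁ Γ₂ Δ M N A B} → Banged Δ →
          (Γ₁ ++ Δ) ⊢ M ∶ (A ⊸ B) → (Γ₂ ++ Δ) ⊢ N ∶ A →
          Θ ↭ (Γ₁ ++ Γ₂ ++ Δ) → Distinct Θ →
          Θ ⊢ app M N ∶ B
    lam₁ : ∀ {Θ Δ x A M B} →
          (Δ ++ (x , A) ∷ []) ⊢ M ∶ B →
          Θ ↭ Δ → Distinct Θ →
          Θ ⊢ lam 0 x A M ∶ (A ⊸ B)
    lam₂ : ∀ {Θ Δ n x A M B} → Banged Δ →
          (Δ ++ (x , A) ∷ []) ⊢ M ∶ B →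
          Θ ↭ Δ → Distinct Θ →
          Θ ⊢ lam (suc n) x A M ∶ !^ (suc n) (A ⊸ B)
    oneI : ∀ {Θ Δ n} → Banged Δ →
          Θ ↭ Δ → Distinct Θ →
          Θ ⊢ star n ∶ !^ n 𝟏
    ⊗I  : ∀ {Θ Δ Γ₁ Γ₂ n M₁ M₂ A₁ A₂} → Banged Δ →
          (Δ ++ Γ₁) ⊢ M₁ ∶ !^ n A₁ → (Δ ++ Γ₂) ⊢ M₂ ∶ !^ n A₂ →
          Θ ↭ (Δ ++ Γ₁ ++ Γ₂) → Distinct Θ →
          Θ ⊢ pair n M₁ M₂ ∶ !^ n (A₁ ⊗ A₂)
    oneE : ∀ {Θ Δ Γ₁ Γ₂ M N A} → Banged Δ →
          (Δ ++ Γ₁) ⊢ M ∶ 𝟏 → (Δ ++ Γ₂) ⊢ N ∶ A →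
          Θ ↭ (Δ ++ Γ₁ ++ Γ₂) → Distinct Θ →
          Θ ⊢ letstar M N ∶ A
    ⊗E  : ∀ {Θ Δ Γ₁ Γ₂ n x₁ x₂ A₁ A₂ M N A} → Banged Δ →
          (Δ ++ Γ₁) ⊢ M ∶ !^ n (A₁ ⊗ A₂) →
          (Δ ++ Γ₂ ++ (x₁ , !^ n A₁) ∷ (x₂ , !^ n A₂) ∷ []) ⊢ N ∶ A →
          Θ ↭ (Δ ++ Γ₁ ++ Γ₂) → Distinct Θ →
          Θ ⊢ letpair n x₁ A₁ x₂ A₂ M N ∶ A

module Submission where

--  * Occurrence lemma (by induction on the typing derivation): whenever
--    Θ ⊢ M : B and x^{A'} occurs free in M, the context Θ declares x at some
--    type A₀ with A₀ <: A'.  The only base case is (ax1), which is exactly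
--    this statement.  Every other rule types its premises in contexts that,
--    after discarding the variables the rule binds, are contained in the
--    conclusion context (up to the permutation built into each rule); a free
--    occurrence is never one of the bound variables, so its declaration
--    transfers from the premise to the conclusion.
--
--  * Contexts of derivable judgments have distinct variables, so a variable
--    is declared at a unique type.  Hence the A₀ above is the declared A.

open import Defs
open import Data.List using (_∷_; []; _++_)
open import Data.List.Properties using (++-assoc)
open import Data.List.Membership.Propositional using (_∈_)
open import Data.List.Membership.Propositional.Properties using (∈-++⁺ʳ; ∈-++⁻; ∈-map⁺)
open import Data.List.Relation.Unary.Any using (here; there)
open import Data.List.Relation.Unary.All as All using (All; _∷_; [])
open import Data.List.Relation.Unary.AllPairs using (_∷_)
open import Data.List.Relation.Unary.Unique.Propositional.Properties using (Unique[x∷xs]⇒x∉xs)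
open import Data.List.Relation.Binary.Subset.Propositional using (_⊆_)
open import Data.List.Relation.Binary.Subset.Propositional.Properties
  using (⊆-refl; ⊆-trans; ⊆-reflexive; ⊆-reflexive-↭; xs⊆xs++ys; xs⊆ys++xs; ++⁺ʳ)
open import Data.List.Relation.Binary.Permutation.Propositional using (_↭_; ↭-sym)
open import Data.Product using (Σ-syntax; _×_; _,_; proj₁; proj₂)
open import Data.Sum using (inj₁; inj₂)
open import Data.Empty using (⊥-elim)
open import Relation.Binary.PropositionalEquality using (_≡_; refl; sym; subst; _≢_)

Declares : Ctx → Var → Ty → Set
Declares Θ x A' = Σ[ A ∈ Ty ] ((x , A) ∈ Θ × A <: A')

declares-⊆ : ∀ {L K x A'} → L ⊆ K → Declares L x A' → Declares K x A'
declares-⊆ L⊆K (A , x∶A , A<:A') = A , L⊆K x∶A , A<:A'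

declares-premise : ∀ {Θ L P x A'} → Θ ↭ L → P ⊆ L → Declares P x A' → Declares Θ x A'
declares-premise Θ↭L P⊆L = declares-⊆ (⊆-trans P⊆L (⊆-reflexive-↭ (↭-sym Θ↭L)))

declares-unbind : ∀ {K x A'} (L : Ctx) → All (λ p → x ≢ proj₁ p) K →
                  Declares (L ++ K) x A' → Declares L x A'
declares-unbind L x-fresh (A , x∶A , A<:A') with ∈-++⁻ L x∶A
... | inj₁ x∶A∈L = A , x∶A∈L , A<:A'
... | inj₂ x∶A∈K = ⊥-elim (All.lookup x-fresh x∶A∈K refl)

declared-type-unique : ∀ {Θ x A A'} → Distinct Θ → (x , A) ∈ Θ → (x , A') ∈ Θ → A ≡ A'
declared-type-unique _       (here refl) (here refl) = refl
declared-type-unique x∉Θ     (here refl) (there x∶A') = ⊥-elim (Unique[x∷xs]⇒x∉xs x∉Θ (∈-map⁺ proj₁ x∶A'))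
declared-type-unique x∉Θ     (there x∶A) (here refl) = ⊥-elim (Unique[x∷xs]⇒x∉xs x∉Θ (∈-map⁺ proj₁ x∶A))
declared-type-unique (_ ∷ u) (there x∶A) (there x∶A') = declared-type-unique u x∶A x∶A'

module _ (Aᶜ : Const → Ty) where
  open Typing Aᶜ

  context-distinct : ∀ {Θ M B} → Θ ⊢ M ∶ B → Distinct Θ
  context-distinct (ax1 _ _ _ u)    = u
  context-distinct (ax2 _ _ _ u)    = u
  context-distinct (app _ _ _ _ u)  = u
  context-distinct (lam₁ _ _ u)     = u
  context-distinct (lam₂ _ _ _ u)   = u
  context-distinct (oneI _ _ u)     = u
  context-distinct (⊗I _ _ _ _ u)   = u
  context-distinct (oneE _ _ _ _ u) = u
  context-distinct (⊗E _ _ _ _ u)   = u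

  occurrence-declared : ∀ {Θ M B x A'} → Θ ⊢ M ∶ B → FreeOcc x A' M → Declares Θ x A'
  occurrence-declared (ax1 {Δ = Δ} {A = A} _ A<:B Θ↭ _) occ-var =
    A , ⊆-reflexive-↭ (↭-sym Θ↭) (∈-++⁺ʳ Δ (here refl)) , A<:B
  occurrence-declared (app {Γ₁ = Γ₁} {Γ₂} {Δ} _ ⊢M _ Θ↭ _) (occ-appˡ o) =
    declares-premise Θ↭ (++⁺ʳ Γ₁ (xs⊆ys++xs Δ Γ₂)) (occurrence-declared ⊢M o)
  occurrence-declared (app {Γ₁ = Γ₁} {Γ₂} {Δ} _ _ ⊢N Θ↭ _) (occ-appʳ o) =
    declares-premise Θ↭ (xs⊆ys++xs (Γ₂ ++ Δ) Γ₁) (occurrence-declared ⊢N o)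
  occurrence-declared (lam₁ {Δ = Δ} ⊢M Θ↭ _) (occ-lam x≢y o) =
    declares-premise Θ↭ ⊆-refl (declares-unbind Δ (x≢y ∷ []) (occurrence-declared ⊢M o))
  occurrence-declared (lam₂ {Δ = Δ} _ ⊢M Θ↭ _) (occ-lam x≢y o) =
    declares-premise Θ↭ ⊆-refl (declares-unbind Δ (x≢y ∷ []) (occurrence-declared ⊢M o))
  occurrence-declared (⊗I {Δ = Δ} {Γ₁} {Γ₂} _ ⊢M _ Θ↭ _) (occ-pairˡ o) =
    declares-premise Θ↭ (++⁺ʳ Δ (xs⊆xs++ys Γ₁ Γ₂)) (occurrence-declared ⊢M o)
  occurrence-declared (⊗I {Δ = Δ} {Γ₁} {Γ₂} _ _ ⊢N Θ↭ _) (occ-pairʳ o) =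
    declares-premise Θ↭ (++⁺ʳ Δ (xs⊆ys++xs Γ₂ Γ₁)) (occurrence-declared ⊢N o)
  occurrence-declared (oneE {Δ = Δ} {Γ₁} {Γ₂} _ ⊢M _ Θ↭ _) (occ-letstarˡ o) =
    declares-premise Θ↭ (++⁺ʳ Δ (xs⊆xs++ys Γ₁ Γ₂)) (occurrence-declared ⊢M o)
  occurrence-declared (oneE {Δ = Δ} {Γ₁} {Γ₂} _ _ ⊢N Θ↭ _) (occ-letstarʳ o) =
    declares-premise Θ↭ (++⁺ʳ Δ (xs⊆ys++xs Γ₂ Γ₁)) (occurrence-declared ⊢N o)
  occurrence-declared (⊗E {Δ = Δ} {Γ₁} {Γ₂} _ ⊢M _ Θ↭ _) (occ-letpairˡ o) =
    declares-premise Θ↭ (++⁺ʳ Δ (xs⊆xs++ys Γ₁ Γ₂)) (occurrence-declared ⊢M o)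
  occurrence-declared (⊗E {Δ = Δ} {Γ₁} {Γ₂} {n} {x₁} {x₂} {A₁} {A₂} _ _ ⊢N Θ↭ _)
                      (occ-letpairʳ x≢x₁ x≢x₂ o) =
    declares-premise Θ↭ (++⁺ʳ Δ (xs⊆ys++xs Γ₂ Γ₁))
      (declares-unbind (Δ ++ Γ₂) (x≢x₁ ∷ x≢x₂ ∷ [])
        (declares-⊆ (⊆-reflexive (sym (++-assoc Δ Γ₂ bound))) (occurrence-declared ⊢N o)))
    where
    bound : Ctx
    bound = (x₁ , !^ n A₁) ∷ (x₂ , !^ n A₂) ∷ []

mainTheorem3 : (Aᶜ : Const → Ty) (Δ : Ctx) (x : Var) (A : Ty) (M : Term) (B : Ty) →
    Typing._⊢_∶_ Aᶜ (Δ ++ (x , A) ∷ []) M B →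
    (A' : Ty) → FreeOcc x A' M → A <: A'
mainTheorem3 Aᶜ Δ x A M B ⊢M A' occurrence
  with occurrence-declared Aᶜ ⊢M occurrence
... | A₀ , x∶A₀ , A₀<:A' = subst (_<: A') (sym A≡A₀) A₀<:A'
  where
  A≡A₀ : A ≡ A₀
  A≡A₀ = declared-type-unique (context-distinct Aᶜ ⊢M) (∈-++⁺ʳ Δ (here refl)) x∶A₀
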